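{- Let $(\omega^\omega)^\infty$ be the set of non-decreasing functions $f\colon\omega\to\omega$ with $\lim_n f(n)=\infty$, and let $\Phi\colon(\omega^\omega)^\infty\to(\omega^\omega)^\infty$ be defined as follows: for $f\in(\omega^\omega)^\infty$ write $\operatorname{ran}(f)=\{n_1<n_2<n_3<\dots\}$, set $n_0=-1$, and for $n\in\omega$ let $i\in\omega$ be the unique index with $n_i\le n<n_{i+1}$, and put $\Phi(f)(n)=\min f^{ -1}(n_{i+1})$. Then for all $f,g\in(\omega^\omega)^\infty$: (1) $f(\Phi(f)(n))>n$ for every $n\in\omega$; (2) $\Phi(f)(f(n))>n$ for every $n\in\omega$; (3) $\Phi(\Phi(f))=f$; (4) if $f(n)\le g(n)$ for all but finitely many $n$, then $\Phi(g)(n)\le\Phi(f)(n)$ for all but finitely many $n$. -}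

module Defs where

open import Data.Nat using (ℕ; zero; suc; _≤_; _<_; _<ᵇ_; _≡ᵇ_)
open import Data.Bool using (Bool; true; false; if_then_else_)
open import Data.Product using (Σ; ∃; ∃-syntax; _×_; proj₁; proj₂)
open import Data.Nat.Properties using (≤-refl)

NonDecreasing : (ℕ → ℕ) → Set
NonDecreasing f = ∀ {m n} → m ≤ n → f m ≤ f n

TendsToInfinity : (ℕ → ℕ) → Set
TendsToInfinity f = ∀ m → ∃[ N ] (∀ n → N ≤ n → m ≤ f n)

InSpace : (ℕ → ℕ) → Set
InSpace f = NonDecreasing f × TendsToInfinity f

Eventually : (ℕ → Set) → Set
Eventually P = ∃[ N ] (∀ n → N ≤ n → P n)

-- bounded minimisation: least k ≤ N with p k ≡ true (N if there is none)
minUpTo : (ℕ → Bool) → ℕ → ℕ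
minUpTo p N = go N 0
  where
  go : ℕ → ℕ → ℕ
  go zero    i = i
  go (suc r) i = if p i then i else go r (suc i)

bound : (f : ℕ → ℕ) → TendsToInfinity f → ℕ → ℕ
bound f t n = proj₁ (t (suc n))

-- n_{i+1}: the least element of ran(f) strictly above n, where n_i ≤ n < n_{i+1}
-- (with n_0 = -1).  For non-decreasing f this is f(least k with n < f k),
-- and such k is ≤ bound f t n.
nextRan : (f : ℕ → ℕ) → TendsToInfinity f → ℕ → ℕ
nextRan f t n = f (minUpTo (λ k → n <ᵇ f k) (bound f t n))

Φ : (f : ℕ → ℕ) → TendsToInfinity f → ℕ → ℕ
Φ f t n = minUpTo (λ k → f k ≡ᵇ nextRan f t n) (bound f t n)

{-# OPTIONS --safe #-}
-- Φ(f)(n) is the least k with n < f(k): the first index where f exceeds n is also the first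
-- index where f takes the next value n_{i+1} of its range.  For non-decreasing f this makes
-- Φ(f) and f the two halves of a Galois connection,  Φ(f)(n) ≤ k  ⇔  n < f(k),  and all four
-- statements are formal consequences of it.
module Submission where

open import Defs
open import Data.Bool using (Bool; true; false; if_then_else_; T)
open import Data.Bool.Properties using (T-≡)
open import Data.Nat using (ℕ; zero; suc; _+_; _≤_; _<_; _<ᵇ_; _≡ᵇ_)
open import Data.Nat.Properties
open import Data.Product using (_×_; _,_; proj₁; proj₂)
open import Data.Sum using (inj₁; inj₂)
open import Function using (_∘_; Equivalence)
open import Relation.Nullary using (¬_)
open import Relation.Binary.PropositionalEquality

Least : (ℕ → Set) → ℕ → Set
Least P m = P m × (∀ k → k < m → ¬ P k)

Least-unique : ∀ {P m n} → Least P m → Least P n → m ≡ n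
Least-unique (Pm , below-m) (Pn , below-n) =
  ≤-antisym (≮⇒≥ (λ n<m → below-m _ n<m Pn)) (≮⇒≥ (λ m<n → below-n _ m<n Pm))

Least-≤ : ∀ {P m k} → Least P m → P k → m ≤ k
Least-≤ (_ , below) Pk = ≮⇒≥ (λ k<m → below _ k<m Pk)

Least-resp : ∀ {P Q : ℕ → Set} {m} → (∀ {k} → P k → Q k) → (∀ {k} → Q k → P k) →
             Least P m → Least Q m
Least-resp P⇒Q Q⇒P (Pm , below) = P⇒Q Pm , λ k k<m → below k k<m ∘ Q⇒P

-- `minUpTo` runs a search loop local to its definition, which cannot be named here.  We reason
-- about any function obeying the loop's equations; with-abstracting the fuel and the start index
-- makes the unfolded goal a pattern, so unification instantiates the function with the loop.
module _ (p : ℕ → Bool) (loop : ℕ → ℕ → ℕ)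
         (loop-zero : ∀ i → loop 0 i ≡ i)
         (loop-suc : ∀ r i → loop (suc r) i ≡ (if p i then i else loop r (suc i)))
         where

  loop-least : ∀ r i {j} → (∀ k → k < i → ¬ T (p k)) → T (p j) → j ≤ r + i →
               Least (T ∘ p) (loop r i)
  loop-least zero i {j} below pj j≤i rewrite loop-zero i =
    subst (T ∘ p) (≤-antisym j≤i (≮⇒≥ (λ j<i → below j j<i pj))) pj , below
  loop-least (suc r) i {j} below pj j≤1+r+i rewrite loop-suc r i with p i in pi
  ... | true  = Equivalence.from T-≡ pi , below
  ... | false = loop-least r (suc i) below′ pj (subst (j ≤_) (sym (+-suc r i)) j≤1+r+i)
    where
    below′ : ∀ k → k < suc i → ¬ T (p k)
    below′ k k<1+i with m≤n⇒m<n∨m≡n (≤-pred k<1+i)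
    ... | inj₁ k<i  = below k k<i
    ... | inj₂ refl = subst T pi

minUpTo-least : (p : ℕ → Bool) (N : ℕ) {j : ℕ} → T (p j) → j ≤ N → Least (T ∘ p) (minUpTo p N)
minUpTo-least p N with loop-least p _ (λ _ → refl) (λ _ _ → refl) | N | 0 in 0≡i
... | least | r | i = λ pj j≤r →
  least r i (subst (λ s → ∀ k → k < s → ¬ T (p k)) 0≡i (λ _ ())) pj (m≤n⇒m≤n+o i j≤r)

module _ (f : ℕ → ℕ) (t : TendsToInfinity f) where

  Φ-least : ∀ n → Least (λ k → n < f k) (Φ f t n)
  Φ-least n = subst (Least (λ k → n < f k)) (sym Φn≡m) m-least
    where
    B : ℕ
    B = bound f t n
    n<f[B] : n < f B
    n<f[B] = proj₂ (t (suc n)) B ≤-refl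
    m : ℕ
    m = minUpTo (λ k → n <ᵇ f k) B
    m-least : Least (λ k → n < f k) m
    m-least = Least-resp (λ {k} → <ᵇ⇒< n (f k)) <⇒<ᵇ
                (minUpTo-least (λ k → n <ᵇ f k) B (<⇒<ᵇ n<f[B]) ≤-refl)
    m-least-preimage : Least (λ k → f k ≡ f m) m
    m-least-preimage =
      refl , λ k k<m fk≡fm → proj₂ m-least k k<m (subst (n <_) (sym fk≡fm) (proj₁ m-least))
    -- `nextRan f t n` unfolds to `f m`.
    Φn≡m : Φ f t n ≡ m
    Φn≡m = Least-unique
      (Least-resp (λ {k} → ≡ᵇ⇒≡ (f k) (f m)) (λ {k} → ≡⇒≡ᵇ (f k) (f m))
        (minUpTo-least (λ k → f k ≡ᵇ f m) B (≡⇒≡ᵇ (f m) (f m) refl) (Least-≤ m-least n<f[B])))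
      m-least-preimage

  n<f[Φn] : ∀ n → n < f (Φ f t n)
  n<f[Φn] n = proj₁ (Φ-least n)

  n<f[k]⇒Φn≤k : ∀ {n k} → n < f k → Φ f t n ≤ k
  n<f[k]⇒Φn≤k = Least-≤ (Φ-least _)

  f[k]≤n⇒k<Φn : NonDecreasing f → ∀ {n k} → f k ≤ n → k < Φ f t n
  f[k]≤n⇒k<Φn f-mono {n} fk≤n =
    ≰⇒> (λ Φn≤k → <⇒≱ (n<f[Φn] n) (≤-trans (f-mono Φn≤k) fk≤n))

  n<Φ[fn] : NonDecreasing f → ∀ n → n < Φ f t (f n)
  n<Φ[fn] f-mono n = f[k]≤n⇒k<Φn f-mono ≤-refl

  Φ-nonDecreasing : NonDecreasing (Φ f t)
  Φ-nonDecreasing {m} {n} m≤n = n<f[k]⇒Φn≤k (≤-<-trans m≤n (n<f[Φn] n))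

  Φ-tendsToInfinity : NonDecreasing f → TendsToInfinity (Φ f t)
  Φ-tendsToInfinity f-mono M = f M , λ n fM≤n → <⇒≤ (f[k]≤n⇒k<Φn f-mono fM≤n)

Φ-involutive : (f : ℕ → ℕ) (t : TendsToInfinity f) → NonDecreasing f →
               (tΦ : TendsToInfinity (Φ f t)) → ∀ n → Φ (Φ f t) tΦ n ≡ f n
Φ-involutive f t f-mono tΦ n = ≤-antisym
  (n<f[k]⇒Φn≤k (Φ f t) tΦ (n<Φ[fn] f t f-mono n))
  (≮⇒≥ (λ ΦΦn<fn → <⇒≱ (n<f[Φn] (Φ f t) tΦ n) (n<f[k]⇒Φn≤k f t ΦΦn<fn)))

Φ-antitone-eventually : (f g : ℕ → ℕ) (tf : TendsToInfinity f) (tg : TendsToInfinity g) →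
  NonDecreasing f → Eventually (λ n → f n ≤ g n) → Eventually (λ n → Φ g tg n ≤ Φ f tf n)
Φ-antitone-eventually f g tf tg f-mono (N , f≤g) with Φ-tendsToInfinity f tf f-mono N
... | N′ , N≤Φ = N′ , λ n N′≤n →
  n<f[k]⇒Φn≤k g tg (<-≤-trans (n<f[Φn] f tf n) (f≤g _ (N≤Φ n N′≤n)))

proposition4p13 : (f g : ℕ → ℕ) (hf : InSpace f) (hg : InSpace g) →
    (∀ n → n < f (Φ f (proj₂ hf) n)) ×
    (∀ n → n < Φ f (proj₂ hf) (f n)) ×
    (InSpace (Φ f (proj₂ hf)) ×
      ((h : InSpace (Φ f (proj₂ hf))) → ∀ n → Φ (Φ f (proj₂ hf)) (proj₂ h) n ≡ f n)) ×
    (Eventually (λ n → f n ≤ g n) →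
      Eventually (λ n → Φ g (proj₂ hg) n ≤ Φ f (proj₂ hf) n))
proposition4p13 f g (f-mono , tf) (_ , tg) =
  n<f[Φn] f tf ,
  n<Φ[fn] f tf f-mono ,
  ((Φ-nonDecreasing f tf , Φ-tendsToInfinity f tf f-mono) ,
   λ (_ , tΦ) → Φ-involutive f tf f-mono tΦ) ,
  Φ-antitone-eventually f g tf tg f-mono
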